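{- Let $G$ be a finite simple connected graph on $\{1,\dots,\ell\}$, let $c$ be the maximal cardinality of a clique in $G$, and let $d$ be the largest entry of the derivation degree sequence of $D(\mathcal{A}(G))$. Then $d\ge c-1$.
   Context: Let $\mathbb{K}$ be a field, $S=\mathbb{K}[x_1,\dots,x_\ell]$ graded by degree, $D_i=\partial/\partial x_i$. $\mathcal{A}(G)=\{\ker(x_i-x_j):\{i,j\}\in E(G)\}$ and $D(\mathcal{A}(G))=\{\theta\in\mathrm{Der}_{\mathbb{K}}(S):\theta(x_i-x_j)\in(x_i-x_j)S\text{ for all edges }\{i,j\}\}$, a graded $S$-module (polynomial degree of $\sum f_kD_k$ is the common degree of the homogeneous $f_k$). The derivation degree sequence is the ordered sequence of polynomial degrees of the elements of a minimal homogeneous generating set of $D(\mathcal{A}(G))$ (independent of the choice). -}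

module Defs where

open import Level using (Level; _⊔_)
open import Data.Nat as ℕ using (ℕ; zero; suc)
open import Data.Bool using (Bool; true; false)
open import Data.Fin using (Fin)
open import Data.Fin.Properties using () renaming (_≟_ to _≟F_)
open import Data.Vec as Vec using (Vec)
open import Data.Vec.Properties using (≡-dec)
open import Data.List as List using (List; []; _∷_; _++_)
open import Data.List.Relation.Unary.AllPairs using (AllPairs)
open import Data.Product using (Σ; ∃; _×_; _,_)
open import Relation.Nullary using (¬_; yes; no)
open import Relation.Binary.PropositionalEquality using (_≡_; _≢_)
open import Algebra.Bundles using (CommutativeRing)

record Field (c ℓ : Level) : Set (Level.suc (c ⊔ ℓ)) where
  field
    commutativeRing : CommutativeRing c ℓ
  open CommutativeRing commutativeRing public
  field
    0≉1     : ¬ (0# ≈ 1#)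
    inverse : ∀ x → ¬ (x ≈ 0#) → ∃ λ y → (x * y) ≈ 1#

record SimpleGraph (n : ℕ) : Set where
  field
    adj     : Fin n → Fin n → Bool
    symm    : ∀ i j → adj i j ≡ adj j i
    irrefl  : ∀ i → adj i i ≡ false

module _ {n : ℕ} (G : SimpleGraph n) where
  open SimpleGraph G

  Edge : Fin n → Fin n → Set
  Edge i j = adj i j ≡ true

  data Walk : Fin n → Fin n → Set where
    [] : ∀ {u} → Walk u u
    _∷_ : ∀ {u v w} → Edge u v → Walk v w → Walk u w

  Connected : Set
  Connected = ∀ u v → Walk u v

  -- a clique: a list of vertices that are pairwise adjacent
  -- (hence pairwise distinct, by irreflexivity)
  IsClique : List (Fin n) → Set
  IsClique = AllPairs Edge

  IsCliqueNumber : ℕ → Set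
  IsCliqueNumber c =
    (∃ λ K → IsClique K × List.length K ≡ c)
    × (∀ K → IsClique K → List.length K ℕ.≤ c)

-- Polynomial ring S = K[x_1,…,x_n], polynomials as finite lists of terms
-- (coefficient, exponent vector); equality is equality of all coefficients.
module Poly {c ℓ' : Level} (K : Field c ℓ') (n : ℕ) where
  open Field K

  Mon : Set
  Mon = Vec ℕ n

  Pol : Set c
  Pol = List (Carrier × Mon)

  coeff : Pol → Mon → Carrier
  coeff [] m = 0#
  coeff ((a , m') ∷ p) m with ≡-dec ℕ._≟_ m' m
  ... | yes _ = a + coeff p m
  ... | no _  = coeff p m

  _≈P_ : Pol → Pol → Set ℓ'
  p ≈P q = ∀ m → coeff p m ≈ coeff q m

  0P : Pol
  0P = []

  _+P_ : Pol → Pol → Pol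
  p +P q = p ++ q

  -P_ : Pol → Pol
  -P p = List.map (λ { (a , m) → (- a , m) }) p

  _-P_ : Pol → Pol → Pol
  p -P q = p +P (-P q)

  _*P_ : Pol → Pol → Pol
  p *P q = List.concatMap (λ { (a , m) →
             List.map (λ { (b , m') → (a * b , Vec.zipWith ℕ._+_ m m') }) q }) p

  var : Fin n → Pol
  var i = (1# , Vec.tabulate (λ j → unit j)) ∷ []
    where
    unit : Fin n → ℕ
    unit j with i ≟F j
    ... | yes _ = 1
    ... | no _  = 0

  mdeg : Mon → ℕ
  mdeg m = Vec.foldr _ ℕ._+_ 0 m

  Homogeneous : ℕ → Pol → Set ℓ'
  Homogeneous d p = ∀ m → mdeg m ≢ d → coeff p m ≈ 0#

  ΣP : ∀ {r} → (Fin r → Pol) → Pol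
  ΣP {zero} f = 0P
  ΣP {suc r} f = f Fin.zero +P ΣP (λ k → f (Fin.suc k))

  -- derivations θ = Σ_k f_k D_k, represented by the coefficient family (f_k)
  Der : Set c
  Der = Fin n → Pol

  _≈D_ : Der → Der → Set ℓ'
  θ ≈D η = ∀ i → θ i ≈P η i

  HomogeneousDer : ℕ → Der → Set ℓ'
  HomogeneousDer d θ = ∀ i → Homogeneous d (θ i)

  -- θ ∈ D(A(G)):  θ(x_i - x_j) = f_i - f_j ∈ (x_i - x_j) S for every edge
  InD : SimpleGraph n → Der → Set (c ⊔ ℓ')
  InD G θ = ∀ i j → Edge G i j →
            ∃ λ g → (θ i -P θ j) ≈P ((var i -P var j) *P g)

  lincomb : ∀ {r} → (Fin r → Pol) → (Fin r → Der) → Der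
  lincomb g θ i = ΣP (λ k → g k *P θ k i)

  Generates : SimpleGraph n → ∀ {r} → (Fin r → Der) → Set (c ⊔ ℓ')
  Generates G {r} θ = ∀ η → InD G η → ∃ λ (g : Fin r → Pol) → η ≈D lincomb g θ

  GeneratesWithout : SimpleGraph n → ∀ {r} → (Fin r → Der) → Fin r → Set (c ⊔ ℓ')
  GeneratesWithout G {r} θ k =
    ∀ η → InD G η → ∃ λ (g : Fin r → Pol) → (g k ≈P 0P) × (η ≈D lincomb g θ)

  record MinimalHomogeneousGenerators (G : SimpleGraph n) (r : ℕ)
         (deg : Fin r → ℕ) (θ : Fin r → Der) : Set (c ⊔ ℓ') where
    field
      members     : ∀ k → InD G (θ k)
      homogeneous : ∀ k → HomogeneousDer (deg k) (θ k)
      generates   : Generates G θ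
      minimal     : ∀ k → ¬ GeneratesWithout G θ k

{-# OPTIONS --safe #-}
-- Let y₀, …, y_R be a clique of G. The derivation η = Σ_v ∏_{j<R} (x_v − x_{y_j}) D_v lies in D(A(G))
-- and is homogeneous of degree R. For θ ∈ D(A(G)) the coefficients θ_{y₀}, …, θ_{y_R} are pairwise
-- congruent modulo the differences x_{y_i} − x_{y_j}, so their divided difference [θ_{y₀}, …, θ_{y_R}]
-- is again a polynomial. This operation is S-linear, lowers degrees by R and sends η to 1, so writing
-- η = Σ g_k θ_k with all generators θ_k of degree < R would give 1 = 0; hence d ≥ R = c − 1.
-- Polynomials are handled through their coefficient functions: divisibility by x_a − x_b is detected
-- by the substitution x_a ↦ x_b, and the quotient is an explicit telescoping sum of coefficients.
-- Connectedness, maximality of the clique, minimality of the generators and d being attained are unused.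

module Submission where

open import Defs
open import Level using (Level)
open import Data.Nat using (ℕ; _≤_; _∸_; NonZero)
open import Data.Fin using (Fin)
open import Data.Product using (∃; _×_)
open import Relation.Binary.PropositionalEquality using (_≡_)

open import Level using (_⊔_)
open import Data.Nat using (zero; suc; pred; z≤n; _<_; _≤?_; _≤ᵇ_; _<ᵇ_) renaming (_+_ to _+ℕ_)
import Data.Nat.Properties as ℕₚ
open ℕₚ using (≤-<-trans; <-≤-trans; ≤-trans; ≰⇒>; m≤m+n; <⇒≢)
open import Data.Bool using (Bool; true; false; _∧_; T)
open import Data.Bool.Properties using (∧-commutativeMonoid; ∧-identityʳ; T-∧)
open import Data.Fin using (zero; suc; inject₁)
import Data.Fin.Properties as Finₚ
open import Data.Vec using (Vec; []; _∷_; lookup; updateAt; zipWith; replicate; sum; tabulate)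
open import Data.Vec.Properties
  using ( ≡-dec; lookup∘updateAt; lookup∘updateAt′; updateAt-updateAt; updateAt-id; updateAt-id-local
        ; updateAt-commutes; lookup-replicate; zipWith-comm; lookup∘tabulate; tabulate∘lookup; tabulate-cong)
open import Data.List as List using (List; []; _∷_; _++_)
import Data.List.Relation.Unary.All as All
open import Data.List.Relation.Unary.AllPairs using (AllPairs; []; _∷_)
open import Data.List.Membership.Propositional.Properties using (∈-lookup)
open import Data.Product using (_,_; proj₁; proj₂)
open import Data.Empty using (⊥-elim)
open import Function using (_∘_)
open import Function.Bundles using (Equivalence)
open import Function.Definitions using (Injective)
open import Relation.Nullary using (yes; no)
open import Algebra.Bundles using (CommutativeMonoid; CommutativeRing)
import Relation.Binary.PropositionalEquality as ≡
open ≡ using (_≢_)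

module ExponentVectors where
  open import Data.Nat using (_+_)
  open ℕₚ using (+-suc; ∸-+-assoc; suc-injective; m+n∸m≡n; m+[n∸m]≡n; ≤ᵇ⇒≤)
  open ≡ using (refl; sym; trans; cong; cong₂)
  open import Algebra.Properties.CommutativeSemigroup (CommutativeMonoid.commutativeSemigroup ∧-commutativeMonoid)
    using (interchange)

  raise lower : ∀ {k} → Fin k → Vec ℕ k → Vec ℕ k
  raise i m = updateAt m i suc
  lower i m = updateAt m i pred

  lookup-raise : ∀ {k} (i : Fin k) m → lookup (raise i m) i ≡ suc (lookup m i)
  lookup-raise i m = lookup∘updateAt i m

  lookup-lower : ∀ {k} (i : Fin k) m → lookup (lower i m) i ≡ pred (lookup m i)
  lookup-lower i m = lookup∘updateAt i m

  lookup-raise-≢ : ∀ {k} {i j : Fin k} m → j ≢ i → lookup (raise i m) j ≡ lookup m j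
  lookup-raise-≢ m j≢i = lookup∘updateAt′ _ _ j≢i m

  lookup-lower-≢ : ∀ {k} {i j : Fin k} m → j ≢ i → lookup (lower i m) j ≡ lookup m j
  lookup-lower-≢ m j≢i = lookup∘updateAt′ _ _ j≢i m

  lower-raise : ∀ {k} (i : Fin k) m → lower i (raise i m) ≡ m
  lower-raise i m = trans (updateAt-updateAt i m) (updateAt-id i m)

  raise-lower : ∀ {k} (i : Fin k) m {j} → lookup m i ≡ suc j → raise i (lower i m) ≡ m
  raise-lower i m e =
    trans (updateAt-updateAt i m) (updateAt-id-local i m (trans (cong (λ x → suc (pred x)) e) (sym e)))

  lower-raise-comm : ∀ {k} {i j : Fin k} m → j ≢ i → lower j (raise i m) ≡ raise i (lower j m)
  lower-raise-comm m j≢i = updateAt-commutes _ _ j≢i m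

  lower-lower-comm : ∀ {k} {i j : Fin k} m → i ≢ j → lower i (lower j m) ≡ lower j (lower i m)
  lower-lower-comm m i≢j = updateAt-commutes _ _ i≢j m

  sum-raise : ∀ {k} (i : Fin k) m → sum (raise i m) ≡ suc (sum m)
  sum-raise zero    (x ∷ m) = refl
  sum-raise (suc i) (x ∷ m) = trans (cong (x +_) (sum-raise i m)) (+-suc x (sum m))

  sum-lower : ∀ {k} (i : Fin k) m {j} → lookup m i ≡ suc j → suc (sum (lower i m)) ≡ sum m
  sum-lower i m e = trans (sym (sum-raise i (lower i m))) (cong sum (raise-lower i m e))

  sum-lower-raise : ∀ {k} (i j : Fin k) m {l} → lookup (raise i m) j ≡ suc l →
                    sum (lower j (raise i m)) ≡ sum m
  sum-lower-raise i j m e = suc-injective (trans (sum-lower j (raise i m) e) (sum-raise i m))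

  infix 4 _≤ᵇᵛ_
  infixl 6 _+ᵛ_ _∸ᵛ_

  _≤ᵇᵛ_ : ∀ {k} → Vec ℕ k → Vec ℕ k → Bool
  []      ≤ᵇᵛ []      = true
  (x ∷ μ) ≤ᵇᵛ (y ∷ m) = (x ≤ᵇ y) ∧ (μ ≤ᵇᵛ m)

  _+ᵛ_ _∸ᵛ_ : ∀ {k} → Vec ℕ k → Vec ℕ k → Vec ℕ k
  μ +ᵛ ν = zipWith _+_ μ ν
  m ∸ᵛ μ = zipWith _∸_ m μ

  -- Not definitional for a variable x: _≤ᵇ_ is defined through the builtin _<ᵇ_.
  ≤ᵇ-suc : ∀ x y → (suc x ≤ᵇ suc y) ≡ (x ≤ᵇ y)
  ≤ᵇ-suc zero    y = refl
  ≤ᵇ-suc (suc x) y = refl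

  ≤ᵇ-∧-≤ᵇ∸ : ∀ x y z → (x ≤ᵇ y) ∧ (z ≤ᵇ y ∸ x) ≡ (x + z ≤ᵇ y)
  ≤ᵇ-∧-≤ᵇ∸ zero    y       z = refl
  ≤ᵇ-∧-≤ᵇ∸ (suc x) zero    z = refl
  ≤ᵇ-∧-≤ᵇ∸ (suc x) (suc y) z = begin
    (suc x ≤ᵇ suc y) ∧ (z ≤ᵇ y ∸ x) ≡⟨ cong (_∧ (z ≤ᵇ y ∸ x)) (≤ᵇ-suc x y) ⟩
    (x ≤ᵇ y) ∧ (z ≤ᵇ y ∸ x)         ≡⟨ ≤ᵇ-∧-≤ᵇ∸ x y z ⟩
    (x + z ≤ᵇ y)                    ≡⟨ ≤ᵇ-suc (x + z) y ⟨
    (suc x + z ≤ᵇ suc y)            ∎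
    where open ≡.≡-Reasoning

  ≤ᵇᵛ-∧-≤ᵇᵛ∸ᵛ : ∀ {k} (μ ν m : Vec ℕ k) →
                 (μ ≤ᵇᵛ m) ∧ (ν ≤ᵇᵛ m ∸ᵛ μ) ≡ (μ +ᵛ ν ≤ᵇᵛ m)
  ≤ᵇᵛ-∧-≤ᵇᵛ∸ᵛ []      []      []      = refl
  ≤ᵇᵛ-∧-≤ᵇᵛ∸ᵛ (x ∷ μ) (z ∷ ν) (y ∷ m) =
    trans (interchange (x ≤ᵇ y) (μ ≤ᵇᵛ m) (z ≤ᵇ y ∸ x) (ν ≤ᵇᵛ m ∸ᵛ μ))
          (cong₂ _∧_ (≤ᵇ-∧-≤ᵇ∸ x y z) (≤ᵇᵛ-∧-≤ᵇᵛ∸ᵛ μ ν m))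

  ∸ᵛ-+ᵛ-assoc : ∀ {k} (m μ ν : Vec ℕ k) → m ∸ᵛ μ ∸ᵛ ν ≡ m ∸ᵛ (μ +ᵛ ν)
  ∸ᵛ-+ᵛ-assoc []      []      []      = refl
  ∸ᵛ-+ᵛ-assoc (y ∷ m) (x ∷ μ) (z ∷ ν) = cong₂ _∷_ (∸-+-assoc y x z) (∸ᵛ-+ᵛ-assoc m μ ν)

  ≤ᵇ-+ : ∀ x y → (x ≤ᵇ x + y) ≡ true
  ≤ᵇ-+ zero    y = refl
  ≤ᵇ-+ (suc x) y = trans (≤ᵇ-suc x (x + y)) (≤ᵇ-+ x y)

  μ≤ᵇᵛμ+ᵛν : ∀ {k} (μ ν : Vec ℕ k) → (μ ≤ᵇᵛ μ +ᵛ ν) ≡ true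
  μ≤ᵇᵛμ+ᵛν []      []      = refl
  μ≤ᵇᵛμ+ᵛν (x ∷ μ) (y ∷ ν) = cong₂ _∧_ (≤ᵇ-+ x y) (μ≤ᵇᵛμ+ᵛν μ ν)

  μ+ᵛν∸ᵛμ≡ν : ∀ {k} (μ ν : Vec ℕ k) → μ +ᵛ ν ∸ᵛ μ ≡ ν
  μ+ᵛν∸ᵛμ≡ν []      []      = refl
  μ+ᵛν∸ᵛμ≡ν (x ∷ μ) (y ∷ ν) = cong₂ _∷_ (m+n∸m≡n x y) (μ+ᵛν∸ᵛμ≡ν μ ν)

  μ+ᵛ[m∸ᵛμ]≡m : ∀ {k} (μ m : Vec ℕ k) → T (μ ≤ᵇᵛ m) → μ +ᵛ (m ∸ᵛ μ) ≡ m
  μ+ᵛ[m∸ᵛμ]≡m []      []      _ = refl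
  μ+ᵛ[m∸ᵛμ]≡m (x ∷ μ) (y ∷ m) h with Equivalence.to T-∧ h
  ... | x≤y , μ≤m = cong₂ _∷_ (m+[n∸m]≡n (≤ᵇ⇒≤ x y x≤y)) (μ+ᵛ[m∸ᵛμ]≡m μ m μ≤m)

  unitVec : ∀ {k} → Fin k → Vec ℕ k
  unitVec i = raise i (replicate _ 0)

  0ᵛ≤ᵇᵛ : ∀ {k} (m : Vec ℕ k) → (replicate k 0 ≤ᵇᵛ m) ≡ true
  0ᵛ≤ᵇᵛ []      = refl
  0ᵛ≤ᵇᵛ (x ∷ m) = 0ᵛ≤ᵇᵛ m

  ∸ᵛ-0ᵛ : ∀ {k} (m : Vec ℕ k) → m ∸ᵛ replicate k 0 ≡ m
  ∸ᵛ-0ᵛ []      = refl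
  ∸ᵛ-0ᵛ (x ∷ m) = cong (x ∷_) (∸ᵛ-0ᵛ m)

  unitVec-≤ᵇᵛ : ∀ {k} (i : Fin k) m → (unitVec i ≤ᵇᵛ m) ≡ (0 <ᵇ lookup m i)
  unitVec-≤ᵇᵛ zero    (x ∷ m) = trans (cong ((1 ≤ᵇ x) ∧_) (0ᵛ≤ᵇᵛ m)) (∧-identityʳ _)
  unitVec-≤ᵇᵛ (suc i) (x ∷ m) = unitVec-≤ᵇᵛ i m

  ∸ᵛ-unitVec : ∀ {k} (i : Fin k) m → m ∸ᵛ unitVec i ≡ lower i m
  ∸ᵛ-unitVec zero    (x ∷ m) = cong₂ _∷_ (n∸1≡pred x) (∸ᵛ-0ᵛ m)
    where n∸1≡pred : ∀ x → x ∸ 1 ≡ pred x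
          n∸1≡pred zero    = refl
          n∸1≡pred (suc x) = refl
  ∸ᵛ-unitVec (suc i) (x ∷ m) = cong (x ∷_) (∸ᵛ-unitVec i m)

open ExponentVectors

module CommutativeRingIdentities {c ℓ} (R : CommutativeRing c ℓ) where
  open CommutativeRing R
  open import Algebra.Properties.AbelianGroup +-abelianGroup
    using (⁻¹-∙-comm; ε⁻¹≈ε; //-rightDividesˡ; //-rightDividesʳ)
  open import Algebra.Properties.CommutativeSemigroup +-commutativeSemigroup using (interchange)
  open import Relation.Binary.Reasoning.Setoid setoid

  x-0≈x : ∀ x → x - 0# ≈ x
  x-0≈x x = trans (+-congˡ ε⁻¹≈ε) (+-identityʳ x)

  [x-y]+y≈x : ∀ x y → (x - y) + y ≈ x
  [x-y]+y≈x x y = //-rightDividesˡ y x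

  x+y≈z⇒z-x≈y : ∀ {x y z} → x + y ≈ z → z - x ≈ y
  x+y≈z⇒z-x≈y {x} {y} {z} eq = begin
    z - x       ≈⟨ +-congʳ eq ⟨
    x + y - x   ≈⟨ +-congʳ (+-comm x y) ⟩
    y + x - x   ≈⟨ //-rightDividesʳ x y ⟩
    y           ∎

  -‿+ : ∀ x y → - (x + y) ≈ - x + - y
  -‿+ x y = sym (⁻¹-∙-comm x y)

  [x+y]-[z+w]≈[x-z]+[y-w] : ∀ x y z w → (x + y) - (z + w) ≈ (x - z) + (y - w)
  [x+y]-[z+w]≈[x-z]+[y-w] x y z w = trans (+-congˡ (-‿+ z w)) (interchange x y (- z) (- w))

  [x-y]-[z-w]≈[x-z]-[y-w] : ∀ x y z w → (x - y) - (z - w) ≈ (x - z) - (y - w)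
  [x-y]-[z-w]≈[x-z]-[y-w] x y z w =
    trans ([x+y]-[z+w]≈[x-z]+[y-w] x (- y) z (- w)) (+-congˡ (sym (-‿+ y (- w))))

  [x-z]-[y-z]≈x-y : ∀ x y z → (x - z) - (y - z) ≈ x - y
  [x-z]-[y-z]≈x-y x y z = begin
    (x - z) - (y - z)   ≈⟨ [x-y]-[z-w]≈[x-z]-[y-w] x z y z ⟩
    (x - y) - (z - z)   ≈⟨ +-congˡ (-‿cong (-‿inverseʳ z)) ⟩
    (x - y) - 0#        ≈⟨ x-0≈x (x - y) ⟩
    x - y               ∎

  -[x-z]+[x-y]≈-[y-z] : ∀ x y z → - (x - z) + (x - y) ≈ - (y - z)
  -[x-z]+[x-y]≈-[y-z] x y z = begin
    - (x - z) + (x - y)   ≈⟨ +-comm _ _ ⟩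
    (x - y) - (x - z)     ≈⟨ [x-y]-[z-w]≈[x-z]-[y-w] x y x z ⟩
    (x - x) - (y - z)     ≈⟨ +-congʳ (-‿inverseʳ x) ⟩
    0# - (y - z)          ≈⟨ +-identityˡ _ ⟩
    - (y - z)             ∎

module Series {c ℓ} (R : CommutativeRing c ℓ) (n : ℕ) where
  open CommutativeRing R hiding (zero)
  open CommutativeRingIdentities R
  open import Algebra.Properties.Ring ring using (x[y-z]≈xy-xz)
  open import Algebra.Properties.AbelianGroup +-abelianGroup using (x∙y⁻¹≈ε⇒x≈y)
  open import Algebra.Properties.CommutativeSemigroup +-commutativeSemigroup using (interchange)
  open import Relation.Binary.Reasoning.Setoid setoid

  -- A polynomial, or more generally a power series, in x₁ … xₙ as its coefficient function.
  Series : Set c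
  Series = Vec ℕ n → Carrier

  infix  4 _≋_
  infixl 6 _+ˢ_ _-ˢ_
  infixr 7 _·ˢ_

  _≋_ : Series → Series → Set ℓ
  f ≋ g = ∀ m → f m ≈ g m

  _+ˢ_ _-ˢ_ : Series → Series → Series
  (f +ˢ g) m = f m + g m
  (f -ˢ g) m = f m - g m

  _·ˢ_ : Carrier → Series → Series
  (a ·ˢ f) m = a * f m

  0ˢ : Series
  0ˢ _ = 0#

  when : Bool → Carrier → Carrier
  when false _ = 0#
  when true  v = v

  when-∧ : ∀ b c v → when b (when c v) ≡ when (b ∧ c) v
  when-∧ false c v = ≡.refl
  when-∧ true  c v = ≡.refl

  when-cong : ∀ b {u v} → u ≈ v → when b u ≈ when b v
  when-cong false _   = refl
  when-cong true  u≈v = u≈v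

  when-+ : ∀ b u v → when b (u + v) ≈ when b u + when b v
  when-+ false u v = sym (+-identityˡ 0#)
  when-+ true  u v = refl

  when-- : ∀ b u v → when b (u - v) ≈ when b u - when b v
  when-- false u v = sym (-‿inverseʳ 0#)
  when-- true  u v = refl

  when-0 : ∀ b → when b 0# ≈ 0#
  when-0 false = refl
  when-0 true  = refl

  -- x^μ · f, x_a · f and (x_a − x_b) · f
  mulMon : Vec ℕ n → Series → Series
  mulMon μ f m = when (μ ≤ᵇᵛ m) (f (m ∸ᵛ μ))

  mulVar : Fin n → Series → Series
  mulVar a f m = when (0 <ᵇ lookup m a) (f (lower a m))

  mulDiff : Fin n → Fin n → Series → Series
  mulDiff a b f = mulVar a f -ˢ mulVar b f

  mulMon-mulMon : ∀ μ ν f m → mulMon μ (mulMon ν f) m ≡ mulMon (μ +ᵛ ν) f m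
  mulMon-mulMon μ ν f m =
    ≡.trans (when-∧ (μ ≤ᵇᵛ m) (ν ≤ᵇᵛ m ∸ᵛ μ) _)
            (≡.cong₂ when (≤ᵇᵛ-∧-≤ᵇᵛ∸ᵛ μ ν m) (≡.cong f (∸ᵛ-+ᵛ-assoc m μ ν)))

  mulVar≡mulMon : ∀ a f m → mulVar a f m ≡ mulMon (unitVec a) f m
  mulVar≡mulMon a f m = ≡.cong₂ when (≡.sym (unitVec-≤ᵇᵛ a m)) (≡.cong f (≡.sym (∸ᵛ-unitVec a m)))

  mulMon-mulVar : ∀ μ a f → mulMon μ (mulVar a f) ≋ mulVar a (mulMon μ f)
  mulMon-mulVar μ a f m = begin
    mulMon μ (mulVar a f) m           ≡⟨ ≡.cong (when (μ ≤ᵇᵛ m)) (mulVar≡mulMon a f (m ∸ᵛ μ)) ⟩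
    mulMon μ (mulMon (unitVec a) f) m  ≡⟨ mulMon-mulMon μ (unitVec a) f m ⟩
    mulMon (μ +ᵛ unitVec a) f m
      ≡⟨ ≡.cong (λ ν → mulMon ν f m) (zipWith-comm ℕₚ.+-comm μ (unitVec a)) ⟩
    mulMon (unitVec a +ᵛ μ) f m        ≡⟨ mulMon-mulMon (unitVec a) μ f m ⟨
    mulMon (unitVec a) (mulMon μ f) m  ≡⟨ mulVar≡mulMon a (mulMon μ f) m ⟨
    mulVar a (mulMon μ f) m            ∎

  mulMon-cong : ∀ μ {f g} → f ≋ g → mulMon μ f ≋ mulMon μ g
  mulMon-cong μ f≋g m = when-cong (μ ≤ᵇᵛ m) (f≋g (m ∸ᵛ μ))

  mulMon-- : ∀ μ f g → mulMon μ (f -ˢ g) ≋ mulMon μ f -ˢ mulMon μ g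
  mulMon-- μ f g m = when-- (μ ≤ᵇᵛ m) _ _

  mulMon-0 : ∀ μ {f} → f ≋ 0ˢ → mulMon μ f ≋ 0ˢ
  mulMon-0 μ f≋0 m = trans (when-cong (μ ≤ᵇᵛ m) (f≋0 _)) (when-0 (μ ≤ᵇᵛ m))

  mulMon-at-+ᵛ : ∀ μ f ν → mulMon μ f (μ +ᵛ ν) ≡ f ν
  mulMon-at-+ᵛ μ f ν rewrite μ≤ᵇᵛμ+ᵛν μ ν | μ+ᵛν∸ᵛμ≡ν μ ν = ≡.refl

  mulMon-cong-at : ∀ μ f g m → (T (μ ≤ᵇᵛ m) → f (m ∸ᵛ μ) ≈ g (m ∸ᵛ μ)) →
                   mulMon μ f m ≈ mulMon μ g m
  mulMon-cong-at μ f g m agree with μ ≤ᵇᵛ m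
  ... | false = refl
  ... | true  = agree _

  mulVar-cong : ∀ a {f g} → f ≋ g → mulVar a f ≋ mulVar a g
  mulVar-cong a f≋g m = when-cong (0 <ᵇ lookup m a) (f≋g (lower a m))

  mulVar-+ : ∀ a f g → mulVar a (f +ˢ g) ≋ mulVar a f +ˢ mulVar a g
  mulVar-+ a f g m = when-+ (0 <ᵇ lookup m a) _ _

  mulVar-- : ∀ a f g → mulVar a (f -ˢ g) ≋ mulVar a f -ˢ mulVar a g
  mulVar-- a f g m = when-- (0 <ᵇ lookup m a) _ _

  mulVar-zero : ∀ a f m → lookup m a ≡ 0 → mulVar a f m ≡ 0#
  mulVar-zero a f m e rewrite e = ≡.refl

  mulVar-suc : ∀ a f m {k} → lookup m a ≡ suc k → mulVar a f m ≡ f (lower a m)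
  mulVar-suc a f m e rewrite e = ≡.refl

  mulVar-raise : ∀ a f m → mulVar a f (raise a m) ≡ f m
  mulVar-raise a f m = ≡.trans (mulVar-suc a f (raise a m) (lookup-raise a m)) (≡.cong f (lower-raise a m))

  mulVar-comm : ∀ a b f → mulVar a (mulVar b f) ≋ mulVar b (mulVar a f)
  mulVar-comm a b f m = begin
    mulVar a (mulVar b f) m              ≡⟨ mulVar≡mulMon a (mulVar b f) m ⟩
    mulMon (unitVec a) (mulVar b f) m    ≈⟨ mulMon-mulVar (unitVec a) b f m ⟩
    mulVar b (mulMon (unitVec a) f) m
      ≡⟨ ≡.cong (when (0 <ᵇ lookup m b)) (mulVar≡mulMon a f (lower b m)) ⟨
    mulVar b (mulVar a f) m              ∎

  mulDiff-cong : ∀ a b {f g} → f ≋ g → mulDiff a b f ≋ mulDiff a b g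
  mulDiff-cong a b f≋g m = +-cong (mulVar-cong a f≋g m) (-‿cong (mulVar-cong b f≋g m))

  mulDiff-+ : ∀ a b f g → mulDiff a b (f +ˢ g) ≋ mulDiff a b f +ˢ mulDiff a b g
  mulDiff-+ a b f g m = begin
    mulVar a (f +ˢ g) m - mulVar b (f +ˢ g) m
      ≈⟨ +-cong (mulVar-+ a f g m) (-‿cong (mulVar-+ b f g m)) ⟩
    (mulVar a f m + mulVar a g m) - (mulVar b f m + mulVar b g m)
      ≈⟨ [x+y]-[z+w]≈[x-z]+[y-w] _ _ _ _ ⟩
    mulDiff a b f m + mulDiff a b g m ∎

  mulDiff-- : ∀ a b f g → mulDiff a b (f -ˢ g) ≋ mulDiff a b f -ˢ mulDiff a b g
  mulDiff-- a b f g m = begin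
    mulVar a (f -ˢ g) m - mulVar b (f -ˢ g) m
      ≈⟨ +-cong (mulVar-- a f g m) (-‿cong (mulVar-- b f g m)) ⟩
    (mulVar a f m - mulVar a g m) - (mulVar b f m - mulVar b g m)
      ≈⟨ [x-y]-[z-w]≈[x-z]-[y-w] _ _ _ _ ⟩
    mulDiff a b f m - mulDiff a b g m ∎

  mulDiff-0 : ∀ a b → mulDiff a b 0ˢ ≋ 0ˢ
  mulDiff-0 a b m =
    trans (+-cong (when-0 (0 <ᵇ lookup m a)) (-‿cong (when-0 (0 <ᵇ lookup m b)))) (-‿inverseʳ 0#)

  mulDiff-self : ∀ a f → mulDiff a a f ≋ 0ˢ
  mulDiff-self a f m = -‿inverseʳ (mulVar a f m)

  mulDiff-comm : ∀ a b c d f → mulDiff a b (mulDiff c d f) ≋ mulDiff c d (mulDiff a b f)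
  mulDiff-comm a b c d f m = begin
    mulDiff a b (mulDiff c d f) m
      ≈⟨ +-cong (mulVar-- a (mulVar c f) (mulVar d f) m) (-‿cong (mulVar-- b (mulVar c f) (mulVar d f) m)) ⟩
    (mulVar a (mulVar c f) m - mulVar a (mulVar d f) m) - (mulVar b (mulVar c f) m - mulVar b (mulVar d f) m)
      ≈⟨ +-cong (+-cong (mulVar-comm a c f m) (-‿cong (mulVar-comm a d f m)))
                (-‿cong (+-cong (mulVar-comm b c f m) (-‿cong (mulVar-comm b d f m)))) ⟩
    (mulVar c (mulVar a f) m - mulVar d (mulVar a f) m) - (mulVar c (mulVar b f) m - mulVar d (mulVar b f) m)
      ≈⟨ [x-y]-[z-w]≈[x-z]-[y-w] _ _ _ _ ⟩
    (mulVar c (mulVar a f) m - mulVar c (mulVar b f) m) - (mulVar d (mulVar a f) m - mulVar d (mulVar b f) m)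
      ≈⟨ +-cong (mulVar-- c (mulVar a f) (mulVar b f) m) (-‿cong (mulVar-- d (mulVar a f) (mulVar b f) m)) ⟨
    mulDiff c d (mulDiff a b f) m ∎

  mulMon-mulDiff : ∀ μ a b f → mulMon μ (mulDiff a b f) ≋ mulDiff a b (mulMon μ f)
  mulMon-mulDiff μ a b f m =
    trans (mulMon-- μ (mulVar a f) (mulVar b f) m)
          (+-cong (mulMon-mulVar μ a f m) (-‿cong (mulMon-mulVar μ b f m)))

  -- orbitSum a b f k p = Σ_{t ≤ k} f (p + t (e_a − e_b)); lower never truncates when k ≤ p_b.
  orbitSum : Fin n → Fin n → Series → ℕ → Series
  orbitSum a b f zero    p = f p
  orbitSum a b f (suc k) p = f p + orbitSum a b f k (lower b (raise a p))

  -- The coefficients of f / (x_a − x_b): telescope f_ν = g_{ν − e_a} − g_{ν − e_b}.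
  quotDiff : Fin n → Fin n → Series → Series
  quotDiff a b f m = orbitSum a b f (lookup m b) (raise a m)

  -- At exponents μ with μ_a = 0, the coefficients of f with x_a replaced by x_b.
  substVar : Fin n → Fin n → Series → Series
  substVar a b f μ = orbitSum a b f (lookup μ b) μ

  Divisible : Fin n → Fin n → Series → Set (c ⊔ ℓ)
  Divisible a b f = ∃ λ g → f ≋ mulDiff a b g

  -- f is homogeneous of the formal degree d − s, which may be negative (and then f ≋ 0ˢ).
  Homogeneous⁻ : ℕ → ℕ → Series → Set ℓ
  Homogeneous⁻ d s f = ∀ m → s +ℕ sum m ≢ d → f m ≈ 0#

  module _ (a b : Fin n) where

    orbitSum-cong : ∀ {f g} → f ≋ g → ∀ k → orbitSum a b f k ≋ orbitSum a b g k
    orbitSum-cong f≋g zero    p = f≋g p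
    orbitSum-cong f≋g (suc k) p = +-cong (f≋g p) (orbitSum-cong f≋g k _)

    orbitSum-+ : ∀ f g k → orbitSum a b (f +ˢ g) k ≋ orbitSum a b f k +ˢ orbitSum a b g k
    orbitSum-+ f g zero    p = refl
    orbitSum-+ f g (suc k) p = trans (+-congˡ (orbitSum-+ f g k _)) (interchange _ _ _ _)

    orbitSum-- : ∀ f g k → orbitSum a b (f -ˢ g) k ≋ orbitSum a b f k -ˢ orbitSum a b g k
    orbitSum-- f g zero    p = refl
    orbitSum-- f g (suc k) p =
      trans (+-congˡ (orbitSum-- f g k _)) (sym ([x+y]-[z+w]≈[x-z]+[y-w] _ _ _ _))

    orbitSum-· : ∀ x f k → orbitSum a b (x ·ˢ f) k ≋ x ·ˢ orbitSum a b f k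
    orbitSum-· x f zero    p = refl
    orbitSum-· x f (suc k) p = trans (+-congˡ (orbitSum-· x f k _)) (sym (distribˡ x _ _))

    orbitSum-0 : ∀ k → orbitSum a b 0ˢ k ≋ 0ˢ
    orbitSum-0 zero    p = refl
    orbitSum-0 (suc k) p = trans (+-congˡ (orbitSum-0 k _)) (+-identityʳ 0#)

    quotDiff-cong : ∀ {f g} → f ≋ g → quotDiff a b f ≋ quotDiff a b g
    quotDiff-cong f≋g m = orbitSum-cong f≋g (lookup m b) (raise a m)

    quotDiff-+ : ∀ f g → quotDiff a b (f +ˢ g) ≋ quotDiff a b f +ˢ quotDiff a b g
    quotDiff-+ f g m = orbitSum-+ f g (lookup m b) (raise a m)

    quotDiff-· : ∀ x f → quotDiff a b (x ·ˢ f) ≋ x ·ˢ quotDiff a b f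
    quotDiff-· x f m = orbitSum-· x f (lookup m b) (raise a m)

    quotDiff-0 : quotDiff a b 0ˢ ≋ 0ˢ
    quotDiff-0 m = orbitSum-0 (lookup m b) (raise a m)

    substVar-cong : ∀ {f g} → f ≋ g → substVar a b f ≋ substVar a b g
    substVar-cong f≋g μ = orbitSum-cong f≋g (lookup μ b) μ

    substVar-- : ∀ f g → substVar a b (f -ˢ g) ≋ substVar a b f -ˢ substVar a b g
    substVar-- f g μ = orbitSum-- f g (lookup μ b) μ

  module _ {a b : Fin n} (a≢b : a ≢ b) where

    private
      b≢a : b ≢ a
      b≢a = a≢b ∘ ≡.sym

      lookup-raise-b : ∀ p → lookup (raise a p) b ≡ lookup p b
      lookup-raise-b p = lookup-raise-≢ p b≢a

      lookup-step : ∀ p {k} → lookup p b ≡ suc k → lookup (lower b (raise a p)) b ≡ k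
      lookup-step p e = ≡.trans (lookup-lower b (raise a p)) (≡.cong pred (≡.trans (lookup-raise-b p) e))

    mulDiff-raise : ∀ g m → mulDiff a b g (raise a m) ≡ g m - mulVar b g (raise a m)
    mulDiff-raise g m = ≡.cong (_- mulVar b g (raise a m)) (mulVar-raise a g m)

    quotDiff-mulDiff : ∀ g → quotDiff a b (mulDiff a b g) ≋ g
    quotDiff-mulDiff g m = go (lookup m b) m ≡.refl
      where
      go : ∀ k m → lookup m b ≡ k → orbitSum a b (mulDiff a b g) k (raise a m) ≈ g m
      go zero m e = begin
        mulDiff a b g (raise a m)          ≡⟨ mulDiff-raise g m ⟩
        g m - mulVar b g (raise a m)
          ≡⟨ ≡.cong (λ v → g m - v) (mulVar-zero b g (raise a m) (≡.trans (lookup-raise-b m) e)) ⟩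
        g m - 0#                           ≈⟨ x-0≈x (g m) ⟩
        g m                                ∎
      go (suc k) m e = begin
        mulDiff a b g (raise a m) + orbitSum a b (mulDiff a b g) k (lower b (raise a (raise a m)))
          ≡⟨ ≡.cong₂ _+_ (mulDiff-raise g m)
                         (≡.cong (orbitSum a b (mulDiff a b g) k) (lower-raise-comm (raise a m) b≢a)) ⟩
        (g m - mulVar b g (raise a m)) + orbitSum a b (mulDiff a b g) k (raise a m′)
          ≈⟨ +-cong (+-congˡ (-‿cong (reflexive (mulVar-suc b g (raise a m) (≡.trans (lookup-raise-b m) e)))))
                    (go k m′ e′) ⟩
        (g m - g m′) + g m′
          ≈⟨ [x-y]+y≈x (g m) (g m′) ⟩
        g m ∎
        where
        m′ = lower b (raise a m)
        e′ = lookup-step m e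

    mulDiff-cancel : ∀ g (P : Vec ℕ n → Set) →
                     (∀ m {k} → P m → lookup m b ≡ suc k → P (lower b (raise a m))) →
                     (∀ m → P m → mulDiff a b g (raise a m) ≈ 0#) → ∀ m → P m → g m ≈ 0#
    mulDiff-cancel g P step-closed vanish m = go (lookup m b) m ≡.refl
      where
      g≈ : ∀ m → P m → g m ≈ mulVar b g (raise a m)
      g≈ m pm = x∙y⁻¹≈ε⇒x≈y _ _ (trans (reflexive (≡.sym (mulDiff-raise g m))) (vanish m pm))
      go : ∀ k m → lookup m b ≡ k → P m → g m ≈ 0#
      go zero    m e pm = trans (g≈ m pm) (reflexive (mulVar-zero b g (raise a m) (≡.trans (lookup-raise-b m) e)))
      go (suc k) m e pm = begin
        g m                       ≈⟨ g≈ m pm ⟩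
        mulVar b g (raise a m)    ≡⟨ mulVar-suc b g (raise a m) (≡.trans (lookup-raise-b m) e) ⟩
        g (lower b (raise a m))   ≈⟨ go k _ (lookup-step m e) (step-closed m pm e) ⟩
        0#                        ∎

    mulVar-quotDiff-source : ∀ f m → mulVar a (quotDiff a b f) m ≡ when (0 <ᵇ lookup m a) (substVar a b f m)
    mulVar-quotDiff-source f m with lookup m a in e
    ... | zero  = ≡.refl
    ... | suc _ = ≡.cong₂ (orbitSum a b f) (lookup-lower-≢ m b≢a) (raise-lower a m e)

    mulVar-quotDiff-target : ∀ f m → mulVar b (quotDiff a b f) m + f m ≈ substVar a b f m
    mulVar-quotDiff-target f m with lookup m b in e
    ... | zero  = +-identityˡ (f m)
    ... | suc k = begin
      orbitSum a b f (lookup (lower b m) b) (raise a (lower b m)) + f m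
        ≡⟨ ≡.cong₂ (λ j p → orbitSum a b f j p + f m)
                   (≡.trans (lookup-lower b m) (≡.cong pred e)) (≡.sym (lower-raise-comm m b≢a)) ⟩
      orbitSum a b f k (lower b (raise a m)) + f m
        ≈⟨ +-comm _ _ ⟩
      f m + orbitSum a b f k (lower b (raise a m)) ∎

    mulDiff-quotDiff : ∀ f → (∀ μ → lookup μ a ≡ 0 → substVar a b f μ ≈ 0#) →
                       mulDiff a b (quotDiff a b f) ≋ f
    mulDiff-quotDiff f vanish m = begin
      mulVar a (quotDiff a b f) m - mulVar b (quotDiff a b f) m
        ≈⟨ +-congʳ (trans (reflexive (mulVar-quotDiff-source f m)) (when-substVar (lookup m a) ≡.refl)) ⟩
      substVar a b f m - mulVar b (quotDiff a b f) m
        ≈⟨ x+y≈z⇒z-x≈y (mulVar-quotDiff-target f m) ⟩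
      f m ∎
      where
      when-substVar : ∀ k → lookup m a ≡ k → when (0 <ᵇ k) (substVar a b f m) ≈ substVar a b f m
      when-substVar zero    e = sym (vanish m e)
      when-substVar (suc _) _ = refl

    quotDiff-divisible : ∀ {f} g → f ≋ mulDiff a b g → quotDiff a b f ≋ g
    quotDiff-divisible g f≋ m = trans (quotDiff-cong a b f≋ m) (quotDiff-mulDiff g m)

    quotDiff-mulMon : ∀ {f} → Divisible a b f → ∀ μ →
                      quotDiff a b (mulMon μ f) ≋ mulMon μ (quotDiff a b f)
    quotDiff-mulMon {f} (g , f≋) μ m = begin
      quotDiff a b (mulMon μ f) m               ≈⟨ quotDiff-cong a b (mulMon-cong μ f≋) m ⟩
      quotDiff a b (mulMon μ (mulDiff a b g)) m ≈⟨ quotDiff-cong a b (mulMon-mulDiff μ a b g) m ⟩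
      quotDiff a b (mulDiff a b (mulMon μ g)) m ≈⟨ quotDiff-mulDiff (mulMon μ g) m ⟩
      mulMon μ g m                              ≈⟨ mulMon-cong μ (quotDiff-divisible g f≋) m ⟨
      mulMon μ (quotDiff a b f) m               ∎

    quotDiff-homogeneous⁻ : ∀ {d s f} → Homogeneous⁻ d s f → Homogeneous⁻ d (suc s) (quotDiff a b f)
    quotDiff-homogeneous⁻ {d} {s} {f} hom m ≢d =
      orbit-vanishes (lookup m b) (raise a m) (lookup-raise-b m) (≢d ∘ ≡.trans (≡.sym degree-raise))
      where
      degree-raise : s +ℕ sum (raise a m) ≡ suc s +ℕ sum m
      degree-raise = ≡.trans (≡.cong (s +ℕ_) (sum-raise a m)) (ℕₚ.+-suc s (sum m))
      orbit-vanishes : ∀ k p → lookup p b ≡ k → s +ℕ sum p ≢ d → orbitSum a b f k p ≈ 0#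
      orbit-vanishes zero    p _ ≢d = hom p ≢d
      orbit-vanishes (suc k) p e ≢d =
        trans (+-cong (hom p ≢d) (orbit-vanishes k _ (lookup-step p e) (≢d ∘ ≡.trans degree-step)))
              (+-identityʳ 0#)
        where
        degree-step = ≡.cong (s +ℕ_) (≡.sym (sum-lower-raise a b p (≡.trans (lookup-raise-b p) e)))

    orbitSum-mulVar-other : ∀ {x} → x ≢ a → x ≢ b → ∀ h k →
                            orbitSum a b (mulVar x h) k ≋ mulVar x (orbitSum a b h k)
    orbitSum-mulVar-other x≢a x≢b h zero    p = refl
    orbitSum-mulVar-other {x} x≢a x≢b h (suc k) p = begin
      mulVar x h p + orbitSum a b (mulVar x h) k p′
        ≈⟨ +-congˡ (orbitSum-mulVar-other x≢a x≢b h k p′) ⟩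
      mulVar x h p + mulVar x (orbitSum a b h k) p′
        ≡⟨ ≡.cong₂ (λ j q → mulVar x h p + when (0 <ᵇ j) (orbitSum a b h k q)) lookup-p′ lower-p′ ⟩
      mulVar x h p + when (0 <ᵇ lookup p x) (orbitSum a b h k (lower b (raise a (lower x p))))
        ≈⟨ when-+ (0 <ᵇ lookup p x) _ _ ⟨
      mulVar x (orbitSum a b h (suc k)) p ∎
      where
      p′ = lower b (raise a p)
      lookup-p′ : lookup p′ x ≡ lookup p x
      lookup-p′ = ≡.trans (lookup-lower-≢ (raise a p) x≢b) (lookup-raise-≢ p x≢a)
      lower-p′ : lower x p′ ≡ lower b (raise a (lower x p))
      lower-p′ = ≡.trans (lower-lower-comm (raise a p) x≢b) (≡.cong (lower b) (lower-raise-comm p x≢a))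

    mulVar-substVar-step : ∀ h p {k} → lookup p b ≡ suc k →
      mulVar b (substVar a b h) p ≈ h (lower b p) + mulVar b (substVar a b h) (lower b (raise a p))
    mulVar-substVar-step h p {k} e = begin
      mulVar b (substVar a b h) p
        ≡⟨ mulVar-suc b (substVar a b h) p e ⟩
      orbitSum a b h (lookup (lower b p) b) (lower b p)
        ≡⟨ ≡.cong (λ j → orbitSum a b h j (lower b p)) (≡.trans (lookup-lower b p) (≡.cong pred e)) ⟩
      orbitSum a b h k (lower b p)
        ≈⟨ unfold k (lookup-step p e) ⟩
      h (lower b p) + mulVar b (substVar a b h) p′ ∎
      where
      p′ = lower b (raise a p)
      unfold : ∀ j → lookup p′ b ≡ j →
               orbitSum a b h j (lower b p) ≈ h (lower b p) + mulVar b (substVar a b h) p′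
      unfold zero    e′ =
        sym (trans (+-congˡ (reflexive (mulVar-zero b (substVar a b h) p′ e′))) (+-identityʳ _))
      unfold (suc j) e′ = +-congˡ (reflexive (≡.sym (≡.trans (mulVar-suc b (substVar a b h) p′ e′)
        (≡.cong₂ (orbitSum a b h) (≡.trans (lookup-lower b p′) (≡.cong pred e′))
                                  (≡.cong (lower b) (lower-raise-comm p b≢a))))))

    orbitSum-mulVar-target : ∀ h k p → lookup p b ≡ k →
                             orbitSum a b (mulVar b h) k p ≈ mulVar b (substVar a b h) p
    orbitSum-mulVar-target h zero    p e =
      trans (reflexive (mulVar-zero b h p e)) (sym (reflexive (mulVar-zero b (substVar a b h) p e)))
    orbitSum-mulVar-target h (suc k) p e = begin
      mulVar b h p + orbitSum a b (mulVar b h) k (lower b (raise a p))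
        ≈⟨ +-cong (reflexive (mulVar-suc b h p e))
                  (orbitSum-mulVar-target h k _ (lookup-step p e)) ⟩
      h (lower b p) + mulVar b (substVar a b h) (lower b (raise a p))
        ≈⟨ mulVar-substVar-step h p e ⟨
      mulVar b (substVar a b h) p ∎

    orbitSum-mulVar-source : ∀ h k p → lookup p b ≡ k →
                             orbitSum a b (mulVar a h) k p ≈ mulVar a h p + mulVar b (substVar a b h) p
    orbitSum-mulVar-source h zero    p e =
      sym (trans (+-congˡ (reflexive (mulVar-zero b (substVar a b h) p e))) (+-identityʳ _))
    orbitSum-mulVar-source h (suc k) p e = begin
      mulVar a h p + orbitSum a b (mulVar a h) k p′
        ≈⟨ +-congˡ (orbitSum-mulVar-source h k p′ (lookup-step p e)) ⟩
      mulVar a h p + (mulVar a h p′ + mulVar b (substVar a b h) p′)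
        ≡⟨ ≡.cong (λ v → mulVar a h p + (v + mulVar b (substVar a b h) p′)) mulVar-a-p′ ⟩
      mulVar a h p + (h (lower b p) + mulVar b (substVar a b h) p′)
        ≈⟨ +-congˡ (mulVar-substVar-step h p e) ⟨
      mulVar a h p + mulVar b (substVar a b h) p ∎
      where
      p′ = lower b (raise a p)
      mulVar-a-p′ : mulVar a h p′ ≡ h (lower b p)
      mulVar-a-p′ =
        ≡.trans (mulVar-suc a h p′ (≡.trans (lookup-lower-≢ (raise a p) a≢b) (lookup-raise a p)))
                (≡.cong h (≡.trans (lower-lower-comm (raise a p) a≢b) (≡.cong (lower b) (lower-raise a p))))

    substVar-mulVar-other : ∀ {x} → x ≢ a → x ≢ b → ∀ h →
                            substVar a b (mulVar x h) ≋ mulVar x (substVar a b h)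
    substVar-mulVar-other {x} x≢a x≢b h μ =
      trans (orbitSum-mulVar-other x≢a x≢b h (lookup μ b) μ)
            (reflexive (≡.cong (λ j → when (0 <ᵇ lookup μ x) (orbitSum a b h j (lower x μ)))
                               (≡.sym (lookup-lower-≢ μ (x≢b ∘ ≡.sym)))))

    substVar-mulVar-target : ∀ h → substVar a b (mulVar b h) ≋ mulVar b (substVar a b h)
    substVar-mulVar-target h μ = orbitSum-mulVar-target h (lookup μ b) μ ≡.refl

    substVar-mulVar-source : ∀ h μ → lookup μ a ≡ 0 →
                             substVar a b (mulVar a h) μ ≈ mulVar b (substVar a b h) μ
    substVar-mulVar-source h μ e =
      trans (orbitSum-mulVar-source h (lookup μ b) μ ≡.refl)
            (trans (+-congʳ (reflexive (mulVar-zero a h μ e))) (+-identityˡ _))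

    substVar-mulDiff-self : ∀ w μ → lookup μ a ≡ 0 → substVar a b (mulDiff a b w) μ ≈ 0#
    substVar-mulDiff-self w μ e =
      trans (substVar-- a b (mulVar a w) (mulVar b w) μ)
            (trans (+-cong (substVar-mulVar-source w μ e) (-‿cong (substVar-mulVar-target w μ))) (-‿inverseʳ _))

    substVar-mulDiff-source : ∀ {r} → r ≢ a → r ≢ b → ∀ h μ → lookup μ a ≡ 0 →
                              substVar a b (mulDiff a r h) μ ≈ mulDiff b r (substVar a b h) μ
    substVar-mulDiff-source r≢a r≢b h μ e =
      trans (substVar-- a b (mulVar a h) (mulVar _ h) μ)
            (+-cong (substVar-mulVar-source h μ e) (-‿cong (substVar-mulVar-other r≢a r≢b h μ)))

    substVar-mulDiff-target : ∀ {r} → r ≢ a → r ≢ b → ∀ h →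
                              substVar a b (mulDiff b r h) ≋ mulDiff b r (substVar a b h)
    substVar-mulDiff-target r≢a r≢b h μ =
      trans (substVar-- a b (mulVar b h) (mulVar _ h) μ)
            (+-cong (substVar-mulVar-target h μ) (-‿cong (substVar-mulVar-other r≢a r≢b h μ)))

  -- After x_a ↦ x_b, (x_b − x_r)(p − q) becomes (f − h) − (g − h) = f − g, which vanishes;
  -- then cancel the nonzerodivisor x_b − x_r.
  quotients-compatible : ∀ {a b r} → a ≢ b → b ≢ r → r ≢ a → ∀ {f g h p q w} →
    f -ˢ g ≋ mulDiff a b w → mulDiff a r p ≋ f -ˢ h → mulDiff b r q ≋ g -ˢ h →
    Divisible a b (p -ˢ q)
  quotients-compatible {a} {b} {r} a≢b b≢r r≢a {f} {g} {h} {p} {q} {w} f-g≋ p≋ q≋ =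
    quotDiff a b (p -ˢ q) , λ m → sym (mulDiff-quotDiff a≢b (p -ˢ q) substituted-vanishes m)
    where
    S = substVar a b
    r≢b = b≢r ∘ ≡.sym
    a≢r = r≢a ∘ ≡.sym
    lookup-a : ∀ m → lookup (raise b m) a ≡ lookup m a
    lookup-a m = lookup-raise-≢ m a≢b
    mulDiff-vanishes : ∀ ν → lookup ν a ≡ 0 → mulDiff b r (S p -ˢ S q) ν ≈ 0#
    mulDiff-vanishes ν e = begin
      mulDiff b r (S p -ˢ S q) ν                  ≈⟨ mulDiff-- b r (S p) (S q) ν ⟩
      mulDiff b r (S p) ν - mulDiff b r (S q) ν
        ≈⟨ +-cong (substVar-mulDiff-source a≢b r≢a r≢b p ν e) (-‿cong (substVar-mulDiff-target a≢b r≢a r≢b q ν)) ⟨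
      S (mulDiff a r p) ν - S (mulDiff b r q) ν
        ≈⟨ +-cong (substVar-cong a b p≋ ν) (-‿cong (substVar-cong a b q≋ ν)) ⟩
      S (f -ˢ h) ν - S (g -ˢ h) ν
        ≈⟨ +-cong (substVar-- a b f h ν) (-‿cong (substVar-- a b g h ν)) ⟩
      (S f ν - S h ν) - (S g ν - S h ν)           ≈⟨ [x-z]-[y-z]≈x-y _ _ _ ⟩
      S f ν - S g ν                               ≈⟨ substVar-- a b f g ν ⟨
      S (f -ˢ g) ν                                ≈⟨ substVar-cong a b f-g≋ ν ⟩
      S (mulDiff a b w) ν                         ≈⟨ substVar-mulDiff-self a≢b w ν e ⟩
      0#                                          ∎
    substituted-vanishes : ∀ μ → lookup μ a ≡ 0 → S (p -ˢ q) μ ≈ 0#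
    substituted-vanishes μ e =
      trans (substVar-- a b p q μ)
            (mulDiff-cancel b≢r (S p -ˢ S q) (λ m → lookup m a ≡ 0)
              (λ m e′ _ → ≡.trans (lookup-lower-≢ (raise b m) a≢r) (≡.trans (lookup-a m) e′))
              (λ m e′ → mulDiff-vanishes (raise b m) (≡.trans (lookup-a m) e′)) μ e)

  Compatible : ∀ {r} → (Fin r → Fin n) → (Fin r → Series) → Set (c ⊔ ℓ)
  Compatible y φ = ∀ i j → i ≢ j → Divisible (y i) (y j) (φ i -ˢ φ j)

  -- divDiff r y φ is the divided difference of φ at the points x_{y 0}, …, x_{y r}, computed
  -- from the first divided differences (φ (i+1) − φ 0) / (x_{y (i+1)} − x_{y 0}).
  divDiff₁ : ∀ {r} → (Fin (suc r) → Fin n) → (Fin (suc r) → Series) → Fin r → Series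
  divDiff₁ y φ i = quotDiff (y (suc i)) (y zero) (φ (suc i) -ˢ φ zero)

  divDiff : ∀ r → (Fin (suc r) → Fin n) → (Fin (suc r) → Series) → Series
  divDiff zero    y φ = φ zero
  divDiff (suc r) y φ = divDiff r (y ∘ suc) (divDiff₁ y φ)

  module _ {r} {y : Fin (suc r) → Fin n} (inj : Injective _≡_ _≡_ y) where

    private
      y≢ : ∀ {i j} → i ≢ j → y i ≢ y j
      y≢ i≢j = i≢j ∘ inj

      suc≢zero : ∀ {i : Fin r} → suc i ≢ zero
      suc≢zero ()

    mulDiff-divDiff₁ : ∀ {φ} → Compatible y φ → ∀ i →
                       mulDiff (y (suc i)) (y zero) (divDiff₁ y φ i) ≋ φ (suc i) -ˢ φ zero
    mulDiff-divDiff₁ compat i m with compat (suc i) zero suc≢zero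
    ... | g , φ≋ = trans (mulDiff-cong _ _ (quotDiff-divisible (y≢ suc≢zero) g φ≋) m) (sym (φ≋ m))

    divDiff₁-compatible : ∀ {φ} → Compatible y φ → Compatible (y ∘ suc) (divDiff₁ y φ)
    divDiff₁-compatible compat i j i≢j with compat (suc i) (suc j) (i≢j ∘ Finₚ.suc-injective)
    ... | w , φ≋ =
      quotients-compatible (y≢ (i≢j ∘ Finₚ.suc-injective)) (y≢ suc≢zero) (y≢ (suc≢zero ∘ ≡.sym))
                           {w = w} φ≋ (mulDiff-divDiff₁ compat i) (mulDiff-divDiff₁ compat j)

    divDiff₁-mulMon : ∀ {φ} → Compatible y φ → ∀ μ i →
                      divDiff₁ y (mulMon μ ∘ φ) i ≋ mulMon μ (divDiff₁ y φ i)
    divDiff₁-mulMon {φ} compat μ i m =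
      trans (quotDiff-cong _ _ (λ m → sym (mulMon-- μ (φ (suc i)) (φ zero) m)) m)
            (quotDiff-mulMon (y≢ suc≢zero) (compat (suc i) zero suc≢zero) μ m)

    divDiff₁-homogeneous⁻ : ∀ {d s φ} → (∀ i → Homogeneous⁻ d s (φ i)) →
                            ∀ i → Homogeneous⁻ d (suc s) (divDiff₁ y φ i)
    divDiff₁-homogeneous⁻ {φ = φ} hom i = quotDiff-homogeneous⁻ (y≢ suc≢zero) {f = φ (suc i) -ˢ φ zero}
      (λ m ≢d → trans (+-cong (hom (suc i) m ≢d) (-‿cong (hom zero m ≢d))) (-‿inverseʳ 0#))

  divDiff₁-cong : ∀ {r} (y : Fin (suc r) → Fin n) {φ ψ} → (∀ i → φ i ≋ ψ i) →
                  ∀ i → divDiff₁ y φ i ≋ divDiff₁ y ψ i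
  divDiff₁-cong y φ≋ψ i = quotDiff-cong _ _ (λ m → +-cong (φ≋ψ (suc i) m) (-‿cong (φ≋ψ zero m)))

  divDiff-cong : ∀ r y {φ ψ} → (∀ i → φ i ≋ ψ i) → divDiff r y φ ≋ divDiff r y ψ
  divDiff-cong zero    y φ≋ψ = φ≋ψ zero
  divDiff-cong (suc r) y φ≋ψ = divDiff-cong r (y ∘ suc) (divDiff₁-cong y φ≋ψ)

  divDiff-+ : ∀ r y φ ψ → divDiff r y (λ i → φ i +ˢ ψ i) ≋ divDiff r y φ +ˢ divDiff r y ψ
  divDiff-+ zero    y φ ψ m = refl
  divDiff-+ (suc r) y φ ψ m =
    trans (divDiff-cong r (y ∘ suc) divDiff₁-+ m) (divDiff-+ r (y ∘ suc) (divDiff₁ y φ) (divDiff₁ y ψ) m)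
    where
    divDiff₁-+ : ∀ i → divDiff₁ y (λ i → φ i +ˢ ψ i) i ≋ divDiff₁ y φ i +ˢ divDiff₁ y ψ i
    divDiff₁-+ i m = trans (quotDiff-cong _ _ (λ m → [x+y]-[z+w]≈[x-z]+[y-w] _ _ _ _) m) (quotDiff-+ _ _ _ _ m)

  divDiff-· : ∀ r y x φ → divDiff r y (λ i → x ·ˢ φ i) ≋ x ·ˢ divDiff r y φ
  divDiff-· zero    y x φ m = refl
  divDiff-· (suc r) y x φ m =
    trans (divDiff-cong r (y ∘ suc) divDiff₁-· m) (divDiff-· r (y ∘ suc) x (divDiff₁ y φ) m)
    where
    divDiff₁-· : ∀ i → divDiff₁ y (λ i → x ·ˢ φ i) i ≋ x ·ˢ divDiff₁ y φ i
    divDiff₁-· i m = trans (quotDiff-cong _ _ (λ m → sym (x[y-z]≈xy-xz x _ _)) m) (quotDiff-· _ _ x _ m)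

  divDiff-0 : ∀ r y → divDiff r y (λ _ → 0ˢ) ≋ 0ˢ
  divDiff-0 zero    y m = refl
  divDiff-0 (suc r) y m = trans (divDiff-cong r (y ∘ suc) divDiff₁-0 m) (divDiff-0 r (y ∘ suc) m)
    where
    divDiff₁-0 : ∀ i → divDiff₁ y (λ _ → 0ˢ) i ≋ 0ˢ
    divDiff₁-0 i m = trans (quotDiff-cong _ _ (λ _ → -‿inverseʳ 0#) m) (quotDiff-0 _ _ m)

  divDiff-mulMon : ∀ r {y} → Injective _≡_ _≡_ y → ∀ {φ} → Compatible y φ → ∀ μ →
                   divDiff r y (mulMon μ ∘ φ) ≋ mulMon μ (divDiff r y φ)
  divDiff-mulMon zero    inj compat μ m = refl
  divDiff-mulMon (suc r) inj compat μ m =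
    trans (divDiff-cong r _ (divDiff₁-mulMon inj compat μ) m)
          (divDiff-mulMon r (Finₚ.suc-injective ∘ inj) (divDiff₁-compatible inj compat) μ m)

  divDiff-homogeneous⁻ : ∀ r {y} → Injective _≡_ _≡_ y → ∀ {d s φ} →
                         (∀ i → Homogeneous⁻ d s (φ i)) → Homogeneous⁻ d (r +ℕ s) (divDiff r y φ)
  divDiff-homogeneous⁻ zero    inj hom = hom zero
  divDiff-homogeneous⁻ (suc r) inj {d} {s} hom m ≢d =
    divDiff-homogeneous⁻ r (Finₚ.suc-injective ∘ inj) (divDiff₁-homogeneous⁻ inj hom) m
      (≢d ∘ ≡.trans (≡.cong (_+ℕ sum m) (≡.sym (ℕₚ.+-suc r s))))

  polyMul : List (Carrier × Vec ℕ n) → Series → Series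
  polyMul []            f = 0ˢ
  polyMul ((a , μ) ∷ g) f = a ·ˢ mulMon μ f +ˢ polyMul g f

  polyMul-0 : ∀ g {f} → f ≋ 0ˢ → polyMul g f ≋ 0ˢ
  polyMul-0 []            f≋0 m = refl
  polyMul-0 ((a , μ) ∷ g) f≋0 m =
    trans (+-cong (trans (*-congˡ (mulMon-0 μ f≋0 m)) (zeroʳ a)) (polyMul-0 g f≋0 m)) (+-identityʳ 0#)

  divDiff-polyMul : ∀ r {y} → Injective _≡_ _≡_ y → ∀ {φ} → Compatible y φ → ∀ g →
                    divDiff r y (polyMul g ∘ φ) ≋ polyMul g (divDiff r y φ)
  divDiff-polyMul r inj compat []            = divDiff-0 r _
  divDiff-polyMul r {y} inj {φ} compat ((a , μ) ∷ g) m = begin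
    divDiff r y (λ i → a ·ˢ mulMon μ (φ i) +ˢ polyMul g (φ i)) m
      ≈⟨ divDiff-+ r y _ _ m ⟩
    divDiff r y (λ i → a ·ˢ mulMon μ (φ i)) m + divDiff r y (polyMul g ∘ φ) m
      ≈⟨ +-cong (divDiff-· r y a _ m) (divDiff-polyMul r inj compat g m) ⟩
    a * divDiff r y (mulMon μ ∘ φ) m + polyMul g (divDiff r y φ) m
      ≈⟨ +-congʳ (*-congˡ (divDiff-mulMon r inj compat μ m)) ⟩
    polyMul ((a , μ) ∷ g) (divDiff r y φ) m ∎

  sumˢ : ∀ {k} → (Fin k → Series) → Series
  sumˢ {zero}  F = 0ˢ
  sumˢ {suc k} F = F zero +ˢ sumˢ (F ∘ suc)

  sumˢ-cong : ∀ {k} {F F′ : Fin k → Series} → (∀ j → F j ≋ F′ j) → sumˢ F ≋ sumˢ F′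
  sumˢ-cong {zero}  F≋ m = refl
  sumˢ-cong {suc k} F≋ m = +-cong (F≋ zero m) (sumˢ-cong (F≋ ∘ suc) m)

  sumˢ-0 : ∀ {k} (F : Fin k → Series) → (∀ j → F j ≋ 0ˢ) → sumˢ F ≋ 0ˢ
  sumˢ-0 {zero}  F F≋0 m = refl
  sumˢ-0 {suc k} F F≋0 m = trans (+-cong (F≋0 zero m) (sumˢ-0 (F ∘ suc) (F≋0 ∘ suc) m)) (+-identityʳ 0#)

  divDiff-sumˢ : ∀ r y {k} (F : Fin k → Fin (suc r) → Series) →
                 divDiff r y (λ i → sumˢ (λ j → F j i)) ≋ sumˢ (λ j → divDiff r y (F j))
  divDiff-sumˢ r y {zero}  F = divDiff-0 r y
  divDiff-sumˢ r y {suc k} F m =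
    trans (divDiff-+ r y (F zero) _ m) (+-congˡ (divDiff-sumˢ r y (F ∘ suc) m))

module PolynomialCoefficients {c ℓ} (K : Field c ℓ) (n : ℕ) where
  open Field K hiding (zero)
  open Poly K n
  open Series commutativeRing n
  open CommutativeRingIdentities commutativeRing
  open import Algebra.Properties.Ring ring using (-1*x≈-x)
  open import Algebra.Properties.AbelianGroup +-abelianGroup using (⁻¹-∙-comm; ε⁻¹≈ε)
  open import Relation.Binary.Reasoning.Setoid setoid

  coeff-++ : ∀ p q → coeff (p ++ q) ≋ coeff p +ˢ coeff q
  coeff-++ []            q m = sym (+-identityˡ _)
  coeff-++ ((a , ν) ∷ p) q m with ≡-dec ℕₚ._≟_ ν m
  ... | yes _ = trans (+-congˡ (coeff-++ p q m)) (sym (+-assoc _ _ _))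
  ... | no  _ = coeff-++ p q m

  coeff-neg : ∀ p m → coeff (-P p) m ≈ - coeff p m
  coeff-neg []            m = sym ε⁻¹≈ε
  coeff-neg ((a , ν) ∷ p) m with ≡-dec ℕₚ._≟_ ν m
  ... | yes _ = trans (+-congˡ (coeff-neg p m)) (⁻¹-∙-comm a _)
  ... | no  _ = coeff-neg p m

  coeff-- : ∀ p q → coeff (p -P q) ≋ coeff p -ˢ coeff q
  coeff-- p q m = trans (coeff-++ p (-P q) m) (+-congˡ (coeff-neg q m))

  coeff-cons-≡ : ∀ b ν p → coeff ((b , ν) ∷ p) ν ≈ b + coeff p ν
  coeff-cons-≡ b ν p with ≡-dec ℕₚ._≟_ ν ν
  ... | yes _   = refl
  ... | no ν≢ν = ⊥-elim (ν≢ν ≡.refl)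

  coeff-cons-≢ : ∀ b ν p m → ν ≢ m → coeff ((b , ν) ∷ p) m ≈ coeff p m
  coeff-cons-≢ b ν p m ν≢m with ≡-dec ℕₚ._≟_ ν m
  ... | yes ν≡m = ⊥-elim (ν≢m ν≡m)
  ... | no  _   = refl

  coeff-term-* : ∀ a μ p → coeff (((a , μ) ∷ []) *P p) ≋ a ·ˢ mulMon μ (coeff p)
  coeff-term-* a μ []            m = sym (trans (*-congˡ (when-0 (μ ≤ᵇᵛ m))) (zeroʳ a))
  coeff-term-* a μ ((b , ν) ∷ p) m with ≡-dec ℕₚ._≟_ (μ +ᵛ ν) m
  ... | yes ≡.refl = begin
    a * b + coeff (((a , μ) ∷ []) *P p) (μ +ᵛ ν)  ≈⟨ +-congˡ (coeff-term-* a μ p (μ +ᵛ ν)) ⟩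
    a * b + a * mulMon μ (coeff p) (μ +ᵛ ν)      ≡⟨ ≡.cong ((a * b +_) ∘ (a *_)) (mulMon-at-+ᵛ μ (coeff p) ν) ⟩
    a * b + a * coeff p ν                        ≈⟨ distribˡ a b (coeff p ν) ⟨
    a * (b + coeff p ν)                          ≈⟨ *-congˡ (coeff-cons-≡ b ν p) ⟨
    a * coeff ((b , ν) ∷ p) ν                    ≡⟨ ≡.cong (a *_) (mulMon-at-+ᵛ μ (coeff ((b , ν) ∷ p)) ν) ⟨
    a * mulMon μ (coeff ((b , ν) ∷ p)) (μ +ᵛ ν)  ∎
  ... | no μ+ν≢m =
    trans (coeff-term-* a μ p m) (*-congˡ (mulMon-cong-at μ (coeff p) (coeff ((b , ν) ∷ p)) m skip))
    where
    skip : T (μ ≤ᵇᵛ m) → coeff p (m ∸ᵛ μ) ≈ coeff ((b , ν) ∷ p) (m ∸ᵛ μ)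
    skip μ≤m =
      sym (coeff-cons-≢ b ν p _ (λ ν≡ → μ+ν≢m (≡.trans (≡.cong (μ +ᵛ_) ν≡) (μ+ᵛ[m∸ᵛμ]≡m μ m μ≤m))))

  coeff-* : ∀ g p → coeff (g *P p) ≋ polyMul g (coeff p)
  coeff-* []            p m = refl
  coeff-* ((a , μ) ∷ g) p m =
    trans (coeff-++ (List.map _ p) (g *P p) m)
          (+-cong (trans (sym (coeff-++[] (List.map _ p))) (coeff-term-* a μ p m)) (coeff-* g p m))
    where
    coeff-++[] : ∀ q → coeff (q ++ []) m ≈ coeff q m
    coeff-++[] q = trans (coeff-++ q [] m) (+-identityʳ _)

  -- var u is the single term (1#, e_u) with e_u built by tabulate; this names e_u.
  exponentOfVar : Fin n → Vec ℕ n
  exponentOfVar u = exponent (var u)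
    where
    exponent : Pol → Vec ℕ n
    exponent []            = replicate n 0
    exponent ((_ , μ) ∷ _) = μ

  exponentOfVar≡unitVec : ∀ u → exponentOfVar u ≡ unitVec u
  exponentOfVar≡unitVec u =
    ≡.trans (≡.sym (tabulate∘lookup (exponentOfVar u)))
            (≡.trans (tabulate-cong lookup-exponent) (tabulate∘lookup (unitVec u)))
    where
    lookup-tabulate : ∀ {f : Fin n → ℕ} {v} → v ≡ tabulate f → ∀ j → lookup v j ≡ f j
    lookup-tabulate {f} ≡.refl = lookup∘tabulate f
    lookup-exponent : ∀ j → lookup (exponentOfVar u) j ≡ lookup (unitVec u) j
    lookup-exponent j with u Finₚ.≟ j | lookup-tabulate {v = exponentOfVar u} ≡.refl j
    ... | yes ≡.refl | e =
      ≡.trans e (≡.sym (≡.trans (lookup-raise u (replicate n 0)) (≡.cong suc (lookup-replicate u 0))))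
    ... | no  u≢j   | e =
      ≡.trans e (≡.sym (≡.trans (lookup-raise-≢ (replicate n 0) (u≢j ∘ ≡.sym)) (lookup-replicate j 0)))

  coeff-mulDiff : ∀ u v g → coeff ((var u -P var v) *P g) ≋ mulDiff u v (coeff g)
  coeff-mulDiff u v g m = begin
    coeff ((var u -P var v) *P g) m
      ≈⟨ coeff-* (var u -P var v) g m ⟩
    1# * mulMon (exponentOfVar u) (coeff g) m + (- 1# * mulMon (exponentOfVar v) (coeff g) m + 0#)
      ≈⟨ +-cong (*-identityˡ _) (trans (+-identityʳ _) (-1*x≈-x _)) ⟩
    mulMon (exponentOfVar u) (coeff g) m - mulMon (exponentOfVar v) (coeff g) m
      ≡⟨ ≡.cong₂ _-_ (mulMon-var u) (mulMon-var v) ⟩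
    mulDiff u v (coeff g) m ∎
    where
    mulMon-var : ∀ w → mulMon (exponentOfVar w) (coeff g) m ≡ mulVar w (coeff g) m
    mulMon-var w = ≡.trans (≡.cong (λ μ → mulMon μ (coeff g) m) (exponentOfVar≡unitVec w))
                           (≡.sym (mulVar≡mulMon w (coeff g) m))

  coeff-ΣP : ∀ {r} (F : Fin r → Pol) → coeff (ΣP F) ≋ sumˢ (coeff ∘ F)
  coeff-ΣP {zero}  F m = refl
  coeff-ΣP {suc r} F m = trans (coeff-++ (F zero) (ΣP (F ∘ suc)) m) (+-congˡ (coeff-ΣP (F ∘ suc) m))

  oneP : Pol
  oneP = (1# , replicate n 0) ∷ []

  coeff-oneP : coeff oneP (replicate n 0) ≈ 1#
  coeff-oneP = trans (coeff-cons-≡ 1# (replicate n 0) []) (+-identityʳ 1#)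

  prodDiffs : Fin n → ∀ {k} → (Fin k → Fin n) → Pol
  prodDiffs w {zero}  z = oneP
  prodDiffs w {suc k} z = (var w -P var (z zero)) *P prodDiffs w (z ∘ suc)

  prodDiffsQuot : Fin n → Fin n → ∀ {k} → (Fin k → Fin n) → Pol
  prodDiffsQuot u v {zero}  z = []
  prodDiffsQuot u v {suc k} z = ((var u -P var (z zero)) *P prodDiffsQuot u v (z ∘ suc)) ++ prodDiffs v (z ∘ suc)

  prodDiffs-difference : ∀ u v {k} (z : Fin k → Fin n) →
    coeff (prodDiffs u z) -ˢ coeff (prodDiffs v z) ≋ mulDiff u v (coeff (prodDiffsQuot u v z))
  prodDiffs-difference u v {zero}  z m = trans (-‿inverseʳ _) (sym (mulDiff-0 u v m))
  prodDiffs-difference u v {suc k} z m = begin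
    coeff (prodDiffs u z) m - coeff (prodDiffs v z) m
      ≈⟨ +-cong (coeff-mulDiff u z₀ (prodDiffs u z′) m) (-‿cong (coeff-mulDiff v z₀ (prodDiffs v z′) m)) ⟩
    mulDiff u z₀ Aᵤ m - mulDiff v z₀ Aᵥ m
      ≈⟨ +-congˡ (-[x-z]+[x-y]≈-[y-z] (mulVar u Aᵥ m) (mulVar v Aᵥ m) (mulVar z₀ Aᵥ m)) ⟨
    mulDiff u z₀ Aᵤ m + (- mulDiff u z₀ Aᵥ m + mulDiff u v Aᵥ m)
      ≈⟨ +-assoc _ _ _ ⟨
    (mulDiff u z₀ Aᵤ m - mulDiff u z₀ Aᵥ m) + mulDiff u v Aᵥ m
      ≈⟨ +-congʳ (mulDiff-- u z₀ Aᵤ Aᵥ m) ⟨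
    mulDiff u z₀ (Aᵤ -ˢ Aᵥ) m + mulDiff u v Aᵥ m
      ≈⟨ +-congʳ (mulDiff-cong u z₀ (prodDiffs-difference u v (z ∘ suc)) m) ⟩
    mulDiff u z₀ (mulDiff u v W) m + mulDiff u v Aᵥ m
      ≈⟨ +-congʳ (mulDiff-comm u z₀ u v W m) ⟩
    mulDiff u v (mulDiff u z₀ W) m + mulDiff u v Aᵥ m
      ≈⟨ mulDiff-+ u v (mulDiff u z₀ W) Aᵥ m ⟨
    mulDiff u v (mulDiff u z₀ W +ˢ Aᵥ) m
      ≈⟨ mulDiff-cong u v (λ m → sym (trans (coeff-++ ((var u -P var z₀) *P prodDiffsQuot u v z′) (prodDiffs v z′) m)
                                            (+-congʳ (coeff-mulDiff u z₀ (prodDiffsQuot u v z′) m)))) m ⟩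
    mulDiff u v (coeff (prodDiffsQuot u v z)) m ∎
    where
    z₀ = z zero
    z′ = z ∘ suc
    Aᵤ = coeff (prodDiffs u z′)
    Aᵥ = coeff (prodDiffs v z′)
    W  = coeff (prodDiffsQuot u v z′)

  coeff-lincomb : ∀ {r} (g : Fin r → Pol) θ i →
                  coeff (lincomb g θ i) ≋ sumˢ (λ k → polyMul (g k) (coeff (θ k i)))
  coeff-lincomb g θ i m = trans (coeff-ΣP (λ k → g k *P θ k i) m) (sumˢ-cong (λ k → coeff-* (g k) (θ k i)) m)

AllPairs-lookup : ∀ {A : Set} {_∼_ : A → A → Set} → (∀ {x y} → x ∼ y → y ∼ x) →
                  ∀ {xs} → AllPairs _∼_ xs → ∀ {i j} → i ≢ j → List.lookup xs i ∼ List.lookup xs j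
AllPairs-lookup sym (px ∷ pxs) {zero}  {zero}  0≢0 = ⊥-elim (0≢0 ≡.refl)
AllPairs-lookup sym (px ∷ pxs) {zero}  {suc j} _   = All.lookup px (∈-lookup j)
AllPairs-lookup sym (px ∷ pxs) {suc i} {zero}  _   = sym (All.lookup px (∈-lookup i))
AllPairs-lookup sym (px ∷ pxs) {suc i} {suc j} i≢j = AllPairs-lookup sym pxs (i≢j ∘ ≡.cong suc)

module _ {n} (G : SimpleGraph n) where
  open SimpleGraph G

  Edge-sym : ∀ {u v} → Edge G u v → Edge G v u
  Edge-sym {u} {v} e = ≡.trans (symm v u) e

  clique-adjacent : ∀ {K} → IsClique G K → ∀ {i j} → i ≢ j → Edge G (List.lookup K i) (List.lookup K j)
  clique-adjacent = AllPairs-lookup Edge-sym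

  clique-injective : ∀ {K} → IsClique G K → Injective _≡_ _≡_ (List.lookup K)
  clique-injective {K} clique {i} {j} Kᵢ≡Kⱼ with i Finₚ.≟ j
  ... | yes i≡j = i≡j
  ... | no  i≢j with ≡.trans (≡.sym (clique-adjacent clique i≢j))
                             (≡.trans (≡.cong (adj (List.lookup K i)) (≡.sym Kᵢ≡Kⱼ)) (irrefl (List.lookup K i)))
  ...   | ()

module CliqueBound {c ℓ} (K : Field c ℓ) (n : ℕ) where
  open Field K hiding (zero)
  open Poly K n
  open Series commutativeRing n
  open CommutativeRingIdentities commutativeRing
  open PolynomialCoefficients K n
  open import Relation.Binary.Reasoning.Setoid setoid

  prodDiffs-InD : ∀ (G : SimpleGraph n) {k} (z : Fin k → Fin n) → InD G (λ v → prodDiffs v z)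
  prodDiffs-InD G z i j _ = prodDiffsQuot i j z , λ m →
    trans (coeff-- (prodDiffs i z) (prodDiffs j z) m)
          (trans (prodDiffs-difference i j z m) (sym (coeff-mulDiff i j (prodDiffsQuot i j z) m)))

  divDiff-prodDiffs : ∀ r {y : Fin (suc r) → Fin n} → Injective _≡_ _≡_ y → ∀ {φ} →
                      (∀ i → φ i ≋ coeff (prodDiffs (y i) (y ∘ inject₁))) → divDiff r y φ ≋ coeff oneP
  divDiff-prodDiffs zero    inj φ≋ = φ≋ zero
  divDiff-prodDiffs (suc r) {y} inj {φ} φ≋ = divDiff-prodDiffs r (Finₚ.suc-injective ∘ inj) divDiff₁≋
    where
    divDiff₁≋ : ∀ i → divDiff₁ y φ i ≋ coeff (prodDiffs (y (suc i)) (y ∘ suc ∘ inject₁))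
    divDiff₁≋ i = quotDiff-divisible (λ e → suc≢0 (inj e)) (coeff P) λ m → begin
      φ (suc i) m - φ zero m
        ≈⟨ +-cong (φ≋ (suc i) m) (-‿cong (φ≋ zero m)) ⟩
      coeff (prodDiffs (y (suc i)) (y ∘ inject₁)) m - coeff (prodDiffs (y zero) (y ∘ inject₁)) m
        ≈⟨ +-cong (coeff-mulDiff (y (suc i)) (y zero) P m)
                  (-‿cong (trans (coeff-mulDiff (y zero) (y zero) P₀ m) (mulDiff-self (y zero) (coeff P₀) m))) ⟩
      mulDiff (y (suc i)) (y zero) (coeff P) m - 0#
        ≈⟨ x-0≈x _ ⟩
      mulDiff (y (suc i)) (y zero) (coeff P) m ∎
      where
      P  = prodDiffs (y (suc i)) (y ∘ suc ∘ inject₁)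
      P₀ = prodDiffs (y zero) (y ∘ suc ∘ inject₁)
      suc≢0 : suc i ≢ zero
      suc≢0 ()

  module _ (G : SimpleGraph n) {R} (y : Fin (suc R) → Fin n) (inj : Injective _≡_ _≡_ y)
           (adjacent : ∀ {i j} → i ≢ j → Edge G (y i) (y j)) where

    InD-compatible : ∀ {θ} → InD G θ → Compatible y (λ i → coeff (θ (y i)))
    InD-compatible {θ} θ∈D i j i≢j with θ∈D (y i) (y j) (adjacent i≢j)
    ... | g , θ≈ = coeff g , λ m →
      trans (sym (coeff-- (θ (y i)) (θ (y j)) m)) (trans (θ≈ m) (coeff-mulDiff (y i) (y j) g m))

    divDiff-low-degree : ∀ {θ d} → HomogeneousDer d θ → d < R →
                         divDiff R y (λ i → coeff (θ (y i))) ≋ 0ˢ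
    divDiff-low-degree {θ} {d} hom d<R q = divDiff-homogeneous⁻ R inj (λ i → hom (y i)) q
      (λ e → <⇒≢ (<-≤-trans d<R (≤-trans (m≤m+n R 0) (m≤m+n _ (sum q)))) (≡.sym e))

    divDiff-lincomb-low-degree : ∀ {r} {deg : Fin r → ℕ} {θ : Fin r → Der} → (∀ k → InD G (θ k)) →
      (∀ k → HomogeneousDer (deg k) (θ k)) → (∀ k → deg k < R) →
      ∀ g → divDiff R y (λ i → coeff (lincomb g θ (y i))) ≋ 0ˢ
    divDiff-lincomb-low-degree {θ = θ} θ∈D hom deg<R g m = begin
      divDiff R y (λ i → coeff (lincomb g θ (y i))) m
        ≈⟨ divDiff-cong R y (λ i → coeff-lincomb g θ (y i)) m ⟩
      divDiff R y (λ i → sumˢ (λ k → polyMul (g k) (Θ k i))) m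
        ≈⟨ divDiff-sumˢ R y (λ k i → polyMul (g k) (Θ k i)) m ⟩
      sumˢ (λ k → divDiff R y (polyMul (g k) ∘ Θ k)) m
        ≈⟨ sumˢ-0 _ (λ k m → trans (divDiff-polyMul R inj (InD-compatible {θ k} (θ∈D k)) (g k) m)
                                   (polyMul-0 (g k) (divDiff-low-degree {θ k} (hom k) (deg<R k)) m)) m ⟩
      0# ∎
      where
      Θ = λ k i → coeff (θ k (y i))

    cliqueDerivation : Der
    cliqueDerivation v = prodDiffs v (y ∘ inject₁)

    degree-bound : ∀ {r deg θ} → MinimalHomogeneousGenerators G r deg θ →
                   ∀ {d} → (∀ k → deg k ≤ d) → R ≤ d
    degree-bound {θ = θ} gens {d} deg≤d with R ≤? d
    ... | yes R≤d = R≤d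
    ... | no  R≰d = ⊥-elim (0≉1 (begin
      0#
        ≈⟨ divDiff-lincomb-low-degree {θ = θ} members homogeneous deg<R g 0ᵛ ⟨
      divDiff R y (λ i → coeff (lincomb g θ (y i))) 0ᵛ
        ≈⟨ divDiff-cong R y (λ i → generated (y i)) 0ᵛ ⟨
      divDiff R y (λ i → coeff (cliqueDerivation (y i))) 0ᵛ
        ≈⟨ divDiff-prodDiffs R inj (λ i m → refl) 0ᵛ ⟩
      coeff oneP 0ᵛ
        ≈⟨ coeff-oneP ⟩
      1# ∎))
      where
      open MinimalHomogeneousGenerators gens
      0ᵛ = replicate n 0
      deg<R = λ k → ≤-<-trans (deg≤d k) (≰⇒> R≰d)
      cliqueDerivation-combination = generates cliqueDerivation (prodDiffs-InD G (y ∘ inject₁))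
      g = proj₁ cliqueDerivation-combination
      generated = proj₂ cliqueDerivation-combination

proposition4p13 : ∀ {c ℓ' : Level} (K : Field c ℓ') (n : ℕ) → .{{NonZero n}} →
    (G : SimpleGraph n) → Connected G →
    (cl : ℕ) → IsCliqueNumber G cl →
    (r : ℕ) (deg : Fin r → ℕ) (θ : Fin r → Poly.Der K n) →
    Poly.MinimalHomogeneousGenerators K n G r deg θ →
    (d : ℕ) → (∀ k → deg k ≤ d) → (∃ λ k → deg k ≡ d) →
    cl ∸ 1 ≤ d
proposition4p13 K n G _ _ (([]    , _      , ≡.refl) , _) r deg θ gens d deg≤d _ = z≤n
proposition4p13 K n G _ _ ((v ∷ C , clique , ≡.refl) , _) r deg θ gens d deg≤d _ =
  CliqueBound.degree-bound K n G (List.lookup (v ∷ C)) (clique-injective G clique) (clique-adjacent G clique)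
    gens deg≤d
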